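{- Let $i\in\{0,1\}$ and let $\varphi$ be a coloring on $\mathbb{N}$ with property $E_i$. Then $\varphi$ is reconstructible.
   Context: A coloring on $\mathbb{N}$ is a function $\varphi:[\mathbb{N}]^2\to\{0,1\}$. It has property $E_i$ if for every finite $F\subseteq\mathbb{N}$ there is $z\in\mathbb{N}\setminus F$ with $\varphi(\{z,x\})=i$ for all $x\in F$. $\mathrm{hom}(\varphi)=\{H\subseteq\mathbb{N}:\ |H|>2 \text{ and } \varphi \text{ is constant on } [H]^2\}$. $\varphi$ is reconstructible if for every coloring $\psi$ on $\mathbb{N}$ with $\mathrm{hom}(\psi)=\mathrm{hom}(\varphi)$ one has $\psi=\varphi$ or $\psi=1-\varphi$. -}

module Defs where

open import Data.Nat using (ℕ)
open import Data.Bool using (Bool; not)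
open import Data.List using (List)
open import Data.List.Membership.Propositional using (_∈_; _∉_)
open import Data.Product using (Σ; ∃; _×_; _,_)
open import Data.Sum using (_⊎_)
open import Relation.Binary.PropositionalEquality using (_≡_; _≢_)
open import Relation.Nullary using (¬_)

-- A coloring φ : [ℕ]² → {0,1}, represented as a function on ordered pairs
-- that is symmetric; its values on the diagonal are irrelevant.
-- Colors 0,1 are false,true.
record Coloring : Set where
  field
    col  : ℕ → ℕ → Bool
    symm : ∀ x y → col x y ≡ col y x
open Coloring public

_⟨_,_⟩ : Coloring → ℕ → ℕ → Bool
φ ⟨ x , y ⟩ = col φ x y

HasE : Bool → Coloring → Set
HasE i φ = ∀ (F : List ℕ) → ∃ λ z → z ∉ F × (∀ x → x ∈ F → φ ⟨ z , x ⟩ ≡ i)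

Subset : Set₁
Subset = ℕ → Set

MoreThanTwo : Subset → Set
MoreThanTwo H = ∃ λ a → ∃ λ b → ∃ λ c →
  H a × H b × H c × a ≢ b × a ≢ c × b ≢ c

ConstantOn : Coloring → Subset → Set
ConstantOn φ H = ∃ λ (c : Bool) → ∀ x y → H x → H y → x ≢ y → φ ⟨ x , y ⟩ ≡ c

InHom : Coloring → Subset → Set
InHom φ H = MoreThanTwo H × ConstantOn φ H

SameHom : Coloring → Coloring → Set₁
SameHom ψ φ = ∀ (H : Subset) → (InHom ψ H → InHom φ H) × (InHom φ H → InHom ψ H)

_≈c_ : Coloring → Coloring → Set
ψ ≈c φ = ∀ x y → x ≢ y → ψ ⟨ x , y ⟩ ≡ φ ⟨ x , y ⟩

_≈c-compl_ : Coloring → Coloring → Set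
ψ ≈c-compl φ = ∀ x y → x ≢ y → ψ ⟨ x , y ⟩ ≡ not (φ ⟨ x , y ⟩)

Reconstructible : Coloring → Set₁
Reconstructible φ = ∀ (ψ : Coloring) → SameHom ψ φ → (ψ ≈c φ) ⊎ (ψ ≈c-compl φ)

-- Let G be the graph of pairs of color i. The triangles of G are φ-homogeneous,
-- hence ψ-homogeneous, and by E_i any two edges of G are joined by a chain of
-- two G-triangles through common G-neighbours; so ψ is constant, say c, on G.
-- If x y is not an edge of G, pick a common G-neighbour z of x and y: were
-- ψ(x y) = c, the triangle x y z would be ψ-homogeneous, hence φ-homogeneous,
-- forcing φ(x y) = i. So ψ takes the value c exactly on G, i.e. ψ = φ if c = i
-- and ψ = 1 - φ otherwise.
module Submission where

open import Defs
open import Data.Bool using (Bool; not; _≟_)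
open import Data.Bool.Properties using (¬-not)
open import Data.Nat using (ℕ)
open import Data.List using (List; []; _∷_)
open import Data.List.Relation.Unary.Any using (here)
open import Data.List.Relation.Unary.All using (All; []; _∷_; tabulate)
open import Data.Product using (∃; _×_; _,_; proj₁; proj₂)
open import Data.Sum using (_⊎_; inj₁; inj₂)
open import Data.Empty using (⊥-elim)
open import Relation.Nullary using (Dec; yes; no)
open import Relation.Binary.PropositionalEquality using (_≡_; _≢_; refl; sym; trans; cong)

record Distinct₃ (x y z : ℕ) : Set where
  constructor distinct₃
  field
    x≢y : x ≢ y
    x≢z : x ≢ z
    y≢z : y ≢ z

record Monochromatic₃ (φ : Coloring) (c : Bool) (x y z : ℕ) : Set where
  constructor monochromatic₃
  field
    φxy : φ ⟨ x , y ⟩ ≡ c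
    φxz : φ ⟨ x , z ⟩ ≡ c
    φyz : φ ⟨ y , z ⟩ ≡ c

triangle : ℕ → ℕ → ℕ → Subset
triangle x y z w = w ≡ x ⊎ w ≡ y ⊎ w ≡ z

module _ {φ : Coloring} {x y z : ℕ} where

  monochromatic⇒inHom : ∀ {c} → Distinct₃ x y z → Monochromatic₃ φ c x y z →
                        InHom φ (triangle x y z)
  monochromatic⇒inHom {c} (distinct₃ x≢y x≢z y≢z) (monochromatic₃ φxy φxz φyz) =
    (x , y , z , inj₁ refl , inj₂ (inj₁ refl) , inj₂ (inj₂ refl) , x≢y , x≢z , y≢z) ,
    (c , constant)
    where
    constant : ∀ u v → triangle x y z u → triangle x y z v → u ≢ v → φ ⟨ u , v ⟩ ≡ c
    constant _ _ (inj₁ refl)        (inj₂ (inj₁ refl)) _ = φxy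
    constant _ _ (inj₁ refl)        (inj₂ (inj₂ refl)) _ = φxz
    constant _ _ (inj₂ (inj₁ refl)) (inj₂ (inj₂ refl)) _ = φyz
    constant _ _ (inj₂ (inj₁ refl)) (inj₁ refl)        _ = trans (symm φ y x) φxy
    constant _ _ (inj₂ (inj₂ refl)) (inj₁ refl)        _ = trans (symm φ z x) φxz
    constant _ _ (inj₂ (inj₂ refl)) (inj₂ (inj₁ refl)) _ = trans (symm φ z y) φyz
    constant _ _ (inj₁ refl)        (inj₁ refl)        u≢u = ⊥-elim (u≢u refl)
    constant _ _ (inj₂ (inj₁ refl)) (inj₂ (inj₁ refl)) u≢u = ⊥-elim (u≢u refl)
    constant _ _ (inj₂ (inj₂ refl)) (inj₂ (inj₂ refl)) u≢u = ⊥-elim (u≢u refl)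

  inHom⇒monochromatic : Distinct₃ x y z → InHom φ (triangle x y z) →
                        ∃ λ c → Monochromatic₃ φ c x y z
  inHom⇒monochromatic (distinct₃ x≢y x≢z y≢z) (_ , c , constant) =
    c , monochromatic₃ (constant x y (inj₁ refl) (inj₂ (inj₁ refl)) x≢y)
                       (constant x z (inj₁ refl) (inj₂ (inj₂ refl)) x≢z)
                       (constant y z (inj₂ (inj₁ refl)) (inj₂ (inj₂ refl)) y≢z)

hom⊆⇒monochromatic₃ : ∀ {φ ψ : Coloring} {c x y z} → (∀ H → InHom φ H → InHom ψ H) →
                      Distinct₃ x y z → Monochromatic₃ φ c x y z →
                      ∃ λ d → Monochromatic₃ ψ d x y z
hom⊆⇒monochromatic₃ {φ} {ψ} hom⊆ distinct mono =
  inHom⇒monochromatic {ψ} distinct (hom⊆ _ (monochromatic⇒inHom {φ} distinct mono))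

equal-if-agree : ∀ {c i f p : Bool} → c ≡ i → (f ≡ i → p ≡ c) → (f ≢ i → p ≢ c) → p ≡ f
equal-if-agree {c} {f = f} refl onEdge offEdge with f ≟ c
... | yes refl = onEdge refl
... | no f≢c   = trans (¬-not (offEdge f≢c)) (sym (¬-not f≢c))

negated-if-disagree : ∀ {c i f p : Bool} → c ≢ i → (f ≡ i → p ≡ c) → (f ≢ i → p ≢ c) →
                      p ≡ not f
negated-if-disagree {c} {i} {f} c≢i onEdge offEdge with f ≟ i
... | yes refl = trans (onEdge refl) (¬-not c≢i)
... | no f≢i   = trans (¬-not (offEdge f≢i)) (cong not (trans (¬-not c≢i) (sym (¬-not f≢i))))

module Reconstruction {i : Bool} {φ : Coloring} (E : HasE i φ) {ψ : Coloring} (same : SameHom ψ φ) where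

  commonNeighbour : (F : List ℕ) → ∃ λ z → All (λ x → z ≢ x × φ ⟨ z , x ⟩ ≡ i) F
  commonNeighbour F with E F
  ... | z , z∉F , φz = z , tabulate (λ x∈F → (λ { refl → z∉F x∈F }) , φz _ x∈F)

  ψ-equal-on-i-triangle : ∀ {x y z} → Distinct₃ x y z → Monochromatic₃ φ i x y z →
                          ψ ⟨ x , y ⟩ ≡ ψ ⟨ y , z ⟩
  ψ-equal-on-i-triangle distinct mono
    with hom⊆⇒monochromatic₃ {ψ = ψ} (λ H → proj₂ (same H)) distinct mono
  ... | _ , monochromatic₃ ψxy _ ψyz = trans ψxy (sym ψyz)

  ψ-along-two-i-triangles : ∀ {a b z z′} → a ≢ b → φ ⟨ a , b ⟩ ≡ i →
                            z ≢ a → z ≢ b → φ ⟨ z , a ⟩ ≡ i → φ ⟨ z , b ⟩ ≡ i →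
                            z′ ≢ z → z′ ≢ a → φ ⟨ z′ , z ⟩ ≡ i → φ ⟨ z′ , a ⟩ ≡ i →
                            ψ ⟨ a , b ⟩ ≡ ψ ⟨ z′ , z ⟩
  ψ-along-two-i-triangles a≢b φab z≢a z≢b φza φzb z′≢z z′≢a φz′z φz′a =
    trans (sym (ψ-equal-on-i-triangle (distinct₃ z≢a z≢b a≢b) (monochromatic₃ φza φzb φab)))
          (sym (ψ-equal-on-i-triangle (distinct₃ z′≢z z′≢a z≢a) (monochromatic₃ φz′z φz′a φza)))

  ψ-constant-on-i-edges : ∀ {a b a′ b′} → a ≢ b → φ ⟨ a , b ⟩ ≡ i →
                          a′ ≢ b′ → φ ⟨ a′ , b′ ⟩ ≡ i → ψ ⟨ a , b ⟩ ≡ ψ ⟨ a′ , b′ ⟩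
  ψ-constant-on-i-edges {a} {b} {a′} {b′} a≢b φab a′≢b′ φa′b′
    with commonNeighbour (a ∷ b ∷ a′ ∷ b′ ∷ [])
  ... | z , (z≢a , φza) ∷ (z≢b , φzb) ∷ (z≢a′ , φza′) ∷ (z≢b′ , φzb′) ∷ []
    with commonNeighbour (z ∷ a ∷ a′ ∷ [])
  ... | z′ , (z′≢z , φz′z) ∷ (z′≢a , φz′a) ∷ (z′≢a′ , φz′a′) ∷ [] =
    trans (ψ-along-two-i-triangles a≢b φab z≢a z≢b φza φzb z′≢z z′≢a φz′z φz′a)
          (sym (ψ-along-two-i-triangles a′≢b′ φa′b′ z≢a′ z≢b′ φza′ φzb′ z′≢z z′≢a′ φz′z φz′a′))

  ψ-differs-off-i-edges : ∀ {a b x y} → a ≢ b → φ ⟨ a , b ⟩ ≡ i →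
                          x ≢ y → φ ⟨ x , y ⟩ ≢ i → ψ ⟨ x , y ⟩ ≢ ψ ⟨ a , b ⟩
  ψ-differs-off-i-edges {x = x} {y} a≢b φab x≢y φxy≢i ψxy≡ψab
    with commonNeighbour (x ∷ y ∷ [])
  ... | z , (z≢x , φzx) ∷ (z≢y , φzy) ∷ []
    with hom⊆⇒monochromatic₃ {ψ} {φ} (λ H → proj₁ (same H)) (distinct₃ z≢x z≢y x≢y)
           (monochromatic₃ (ψ-constant-on-i-edges z≢x φzx a≢b φab)
                           (ψ-constant-on-i-edges z≢y φzy a≢b φab)
                           ψxy≡ψab)
  ... | _ , monochromatic₃ φzx≡d _ φxy≡d = φxy≢i (trans φxy≡d (trans (sym φzx≡d) φzx))

mainTheorem10 : (i : Bool) (φ : Coloring) → HasE i φ → Reconstructible φ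
mainTheorem10 i φ E ψ same with E (0 ∷ [])
... | a , a∉[0] , φa = reconstruct (ψ ⟨ a , 0 ⟩ ≟ i)
  where
  open Reconstruction {i} {φ} E {ψ} same

  a≢0 : a ≢ 0
  a≢0 a≡0 = a∉[0] (here a≡0)

  φa0 : φ ⟨ a , 0 ⟩ ≡ i
  φa0 = φa 0 (here refl)

  onEdge : ∀ {x y} → x ≢ y → φ ⟨ x , y ⟩ ≡ i → ψ ⟨ x , y ⟩ ≡ ψ ⟨ a , 0 ⟩
  onEdge x≢y φxy = ψ-constant-on-i-edges x≢y φxy a≢0 φa0

  offEdge : ∀ {x y} → x ≢ y → φ ⟨ x , y ⟩ ≢ i → ψ ⟨ x , y ⟩ ≢ ψ ⟨ a , 0 ⟩
  offEdge = ψ-differs-off-i-edges a≢0 φa0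

  reconstruct : Dec (ψ ⟨ a , 0 ⟩ ≡ i) → (ψ ≈c φ) ⊎ (ψ ≈c-compl φ)
  reconstruct (yes c≡i) = inj₁ λ _ _ x≢y → equal-if-agree c≡i (onEdge x≢y) (offEdge x≢y)
  reconstruct (no c≢i)  = inj₂ λ _ _ x≢y → negated-if-disagree c≢i (onEdge x≢y) (offEdge x≢y)
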